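{- Let $\mathbb K\subset\overline{\mathbb F_2}$ be a subfield and let $\sigma$ be the quadratic map defined below. Then $\sigma$ maps $1+X\mathbb K[[X]]$ to itself and restricts to a bijection $1+X\mathbb K[[X]]\to 1+X\mathbb K[[X]]$.
   Context: For $A=\sum_{n\ge0}\alpha_nX^n\in\overline{\mathbb F_2}[[X]]$, $\sigma(A)=\alpha_0^2+\sum_{n\ge0}\alpha_{2^n}^2X^{2^{n+1}}+\sum_{0\le i<j}\binom{i+j}{i}\alpha_i\alpha_jX^{i+j}$ (binomial coefficients reduced mod 2). -}

module Defs where

open import Level using (Level; _⊔_) renaming (suc to lsuc)
open import Algebra.Bundles using (CommutativeRing)
open import Data.Nat as ℕ using (ℕ; zero; suc; _∸_; _<?_; _≟_)
open import Data.Nat.DivMod using (_%_)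
open import Data.Nat.Combinatorics using (_C_)
open import Data.Bool using (if_then_else_; _∧_)
open import Data.Product using (∃; _×_)
open import Relation.Nullary using (¬_; does)

module _ {c ℓ : Level} (R : CommutativeRing c ℓ) where
  open CommutativeRing R

  pow : Carrier → ℕ → Carrier
  pow x zero    = 1#
  pow x (suc n) = x * pow x n

-- A subfield K of the algebraic closure of F₂, presented abstractly (up to
-- isomorphism): a field of characteristic 2 each of whose elements is
-- algebraic over F₂, i.e. satisfies x ^ (2 ^ (m+1)) = x for some m
-- (equivalently lies in a finite subfield F_{2^(m+1)}).  Such fields are
-- exactly the fields isomorphic to subfields of the algebraic closure of F₂.
record SubfieldOfF2bar (c ℓ : Level) : Set (lsuc (c ⊔ ℓ)) where
  field
    cring : CommutativeRing c ℓ
  open CommutativeRing cring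
  field
    nontrivial : ¬ (1# ≈ 0#)
    inverse    : ∀ x → ¬ (x ≈ 0#) → ∃ λ y → x * y ≈ 1#
    char2      : 1# + 1# ≈ 0#
    algebraic  : ∀ x → ∃ λ m → pow cring x (2 ℕ.^ suc m) ≈ x
  open CommutativeRing cring public

module _ {c ℓ : Level} (R : CommutativeRing c ℓ) where
  open CommutativeRing R

  PowerSeries : Set c
  PowerSeries = ℕ → Carrier

  sumBelow : ℕ → (ℕ → Carrier) → Carrier
  sumBelow zero    f = 0#
  sumBelow (suc n) f = sumBelow n f + f n

  -- Coefficient of X^n in σ(A):
  --   [n = 0] α₀²
  -- + Σ_{k ≥ 0, 2^(k+1) = n} α_{2^k}²
  -- + Σ_{0 ≤ i < j, i + j = n} (binom(i+j, i) mod 2) α_i α_j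
  -- (in the last sum, j = n ∸ i and i < j ⇔ 2i < n; the binomial coefficient
  --  reduced mod 2 is 0 or 1, so the term is α_i α_j or 0).
  σ : PowerSeries → PowerSeries
  σ A n =
      (if does (n ≟ 0) then A 0 * A 0 else 0#)
    + sumBelow n (λ k → if does (2 ℕ.^ suc k ≟ n)
                          then A (2 ℕ.^ k) * A (2 ℕ.^ k) else 0#)
    + sumBelow n (λ i → if does (2 ℕ.* i <? n) ∧ does ((n C i) % 2 ≟ 1)
                          then A i * A (n ∸ i) else 0#)

  OnePlusX : PowerSeries → Set ℓ
  OnePlusX A = A 0 ≈ 1#

{-# OPTIONS --safe #-}
-- In σ(A)_n the only monomial involving α_n is α_0 α_n (from i = 0, since binom(n, 0) = 1), so on
-- 1 + X K[[X]] we have σ(A)_n = α_n + (a polynomial in α_0, …, α_{n-1}).  Such a unitriangular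
-- system is uniquely solvable coefficient by coefficient, over any commutative ring: none of the
-- field axioms of K are needed.
module Submission where

open import Level using (Level)
open import Algebra.Bundles using (Group; CommutativeRing)
open import Data.Bool using (true; false; T; if_then_else_; _∧_)
open import Data.Bool.Properties using (T-∧)
open import Data.Unit using (tt)
open import Function.Bundles using (Equivalence)
open import Data.Nat as ℕ using (ℕ; zero; suc; _∸_; _<_; _<?_; _≟_; s≤s; z≤n)
open import Data.Nat.Properties using (^-monoʳ-<; n<1+n; ≤-<-trans; m≤n*m; m∸n≤m; ≤∧≢⇒<)
open import Data.Nat.Combinatorics using (_C_)
open import Data.Nat.DivMod using (_%_)
open import Data.Nat.Induction using (<-rec)
open import Data.Product using (∃; _×_; _,_; proj₁)
open import Relation.Nullary using (Dec; does; yes; no; contradiction)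
open import Relation.Binary.PropositionalEquality as ≡ using (_≡_)

open import Defs

does⇒ : ∀ {p} {P : Set p} (d : Dec P) → T (does d) → P
does⇒ (yes p) _ = p

module Unitriangular {a ℓ : Level} (G : Group a ℓ) where
  open Group G
  open import Algebra.Properties.Group G using (∙-cancelʳ; //-rightDividesˡ)

  Sequence : Set a
  Sequence = ℕ → Carrier

  AgreeBelow : ℕ → Sequence → Sequence → Set ℓ
  AgreeBelow n A B = ∀ {k} → k < n → A k ≈ B k

  module _ (L : Sequence → ℕ → Carrier)
           (L-local : ∀ {A B} n → AgreeBelow n A B → L A n ≈ L B n) where

    unitriangular-injective : ∀ A B → (∀ n → A n ∙ L A n ≈ B n ∙ L B n) → ∀ n → A n ≈ B n
    unitriangular-injective A B eq = <-rec _ λ n A≈B-below →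
      ∙-cancelʳ (L A n) (A n) (B n)
        (trans (eq n) (∙-congˡ (sym (L-local n A≈B-below))))

    -- approximation n solves the first n equations; the next one fixes coefficient n
    approximation : Sequence → ℕ → Sequence
    approximation B zero          = λ _ → ε
    approximation B (suc n) k with k ≟ n
    ... | yes _ = B n // L (approximation B n) n
    ... | no  _ = approximation B n k

    solution : Sequence → Sequence
    solution B n = approximation B (suc n) n

    solution-≡ : ∀ B n → solution B n ≡ B n // L (approximation B n) n
    solution-≡ B n with n ≟ n
    ... | yes _   = ≡.refl
    ... | no  n≢n = contradiction ≡.refl n≢n

    approximation-stable : ∀ B {k} n → k < n → approximation B n k ≡ solution B k
    approximation-stable B {k} (suc n) (s≤s k≤n) with k ≟ n
    ... | yes ≡.refl = ≡.sym (solution-≡ B k)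
    ... | no  k≢n    = approximation-stable B n (≤∧≢⇒< k≤n k≢n)

    solution-solves : ∀ B n → solution B n ∙ L (solution B) n ≈ B n
    solution-solves B n = begin
      solution B n ∙ L (solution B) n
        ≈⟨ ∙-cong (reflexive (solution-≡ B n))
                  (L-local n λ k<n → reflexive (≡.sym (approximation-stable B _ k<n))) ⟩
      (B n // L (approximation B n) n) ∙ L (approximation B n) n
        ≈⟨ //-rightDividesˡ _ _ ⟩
      B n ∎
      where open import Relation.Binary.Reasoning.Setoid setoid

    unitriangular-surjective : ∀ B → ∃ λ A → ∀ n → A n ∙ L A n ≈ B n
    unitriangular-surjective B = solution B , solution-solves B

module SigmaCoefficients {c ℓ : Level} (R : CommutativeRing c ℓ) where
  open CommutativeRing R
  open Unitriangular +-group using (AgreeBelow; unitriangular-injective; unitriangular-surjective)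
  open import Algebra.Properties.CommutativeSemigroup +-commutativeSemigroup using (x∙yz≈y∙xz)
  open import Relation.Binary.Reasoning.Setoid setoid

  squareTerm : PowerSeries R → ℕ → ℕ → Carrier
  squareTerm A n k = if does (2 ℕ.^ suc k ≟ n) then A (2 ℕ.^ k) * A (2 ℕ.^ k) else 0#

  crossTerm : PowerSeries R → ℕ → ℕ → Carrier
  crossTerm A n i = if does (2 ℕ.* i <? n) ∧ does ((n C i) % 2 ≟ 1) then A i * A (n ∸ i) else 0#

  -- σ(A)_n with the monomial α_0 α_n (the cross term i = 0) removed
  σ-lowerOrder : PowerSeries R → ℕ → Carrier
  σ-lowerOrder A zero    = 0#
  σ-lowerOrder A (suc m) =
    sumBelow R (suc m) (squareTerm A (suc m)) + sumBelow R m (λ i → crossTerm A (suc m) (suc i))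

  sumBelow-cong : ∀ n {f g : ℕ → Carrier} → (∀ k → f k ≈ g k) → sumBelow R n f ≈ sumBelow R n g
  sumBelow-cong zero    f≈g = refl
  sumBelow-cong (suc n) f≈g = +-cong (sumBelow-cong n f≈g) (f≈g n)

  sumBelow-suc : ∀ n (f : ℕ → Carrier) → sumBelow R (suc n) f ≈ f 0 + sumBelow R n (λ i → f (suc i))
  sumBelow-suc zero    f = +-comm 0# (f 0)
  sumBelow-suc (suc n) f = begin
    sumBelow R (suc n) f + f (suc n)                    ≈⟨ +-congʳ (sumBelow-suc n f) ⟩
    (f 0 + sumBelow R n (λ i → f (suc i))) + f (suc n)  ≈⟨ +-assoc _ _ _ ⟩
    f 0 + (sumBelow R n (λ i → f (suc i)) + f (suc n))  ∎

  σ-unitriangular : ∀ A n → σ R A n ≈ A 0 * A n + σ-lowerOrder A n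
  σ-unitriangular A zero    = +-identityʳ _
  σ-unitriangular A (suc m) = begin
    (0# + S) + sumBelow R (suc m) (crossTerm A (suc m))  ≈⟨ +-cong (+-identityˡ S) (sumBelow-suc m _) ⟩
    S + (A 0 * A (suc m) + C)                            ≈⟨ x∙yz≈y∙xz S _ C ⟩
    A 0 * A (suc m) + (S + C)                            ∎
    where
      S = sumBelow R (suc m) (squareTerm A (suc m))
      C = sumBelow R m (λ i → crossTerm A (suc m) (suc i))

  if-then-0#-cong : ∀ b {x y} → (T b → x ≈ y) → (if b then x else 0#) ≈ (if b then y else 0#)
  if-then-0#-cong true  x≈y = x≈y tt
  if-then-0#-cong false _   = refl

  squareTerm-local : ∀ {A B} n → AgreeBelow n A B → ∀ k → squareTerm A n k ≈ squareTerm B n k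
  squareTerm-local n A≈B k = if-then-0#-cong (does (2 ℕ.^ suc k ≟ n)) λ t →
    let 2^k<n = ≡.subst (2 ℕ.^ k <_) (does⇒ (2 ℕ.^ suc k ≟ n) t) (^-monoʳ-< 2 (s≤s (s≤s z≤n)) (n<1+n k))
    in *-cong (A≈B 2^k<n) (A≈B 2^k<n)

  crossTerm-local : ∀ {A B} m → AgreeBelow (suc m) A B → ∀ i →
                    crossTerm A (suc m) (suc i) ≈ crossTerm B (suc m) (suc i)
  crossTerm-local m A≈B i = if-then-0#-cong (does (2 ℕ.* suc i <? suc m) ∧ _) λ t →
    let 2[1+i]<1+m = does⇒ (2 ℕ.* suc i <? suc m) (proj₁ (Equivalence.to T-∧ t))
    in *-cong (A≈B (≤-<-trans (m≤n*m (suc i) 2) 2[1+i]<1+m)) (A≈B (s≤s (m∸n≤m m i)))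

  σ-lowerOrder-local : ∀ {A B} n → AgreeBelow n A B → σ-lowerOrder A n ≈ σ-lowerOrder B n
  σ-lowerOrder-local zero    A≈B = refl
  σ-lowerOrder-local (suc m) A≈B =
    +-cong (sumBelow-cong (suc m) (squareTerm-local (suc m) A≈B))
           (sumBelow-cong m (crossTerm-local m A≈B))

  σ-onePlusX : ∀ {A} → OnePlusX R A → ∀ n → σ R A n ≈ A n + σ-lowerOrder A n
  σ-onePlusX {A} A₀≈1 n = trans (σ-unitriangular A n) (+-congʳ (trans (*-congʳ A₀≈1) (*-identityˡ (A n))))

  σ-preserves-onePlusX : ∀ A → OnePlusX R A → OnePlusX R (σ R A)
  σ-preserves-onePlusX A A₀≈1 = trans (σ-onePlusX {A} A₀≈1 0) (trans (+-identityʳ (A 0)) A₀≈1)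

  σ-injective-onePlusX : ∀ A B → OnePlusX R A → OnePlusX R B →
                         (∀ n → σ R A n ≈ σ R B n) → ∀ n → A n ≈ B n
  σ-injective-onePlusX A B A₀≈1 B₀≈1 σA≈σB =
    unitriangular-injective σ-lowerOrder σ-lowerOrder-local A B λ n →
      trans (sym (σ-onePlusX A₀≈1 n)) (trans (σA≈σB n) (σ-onePlusX B₀≈1 n))

  σ-surjective-onePlusX : ∀ B → OnePlusX R B → ∃ λ A → OnePlusX R A × (∀ n → σ R A n ≈ B n)
  σ-surjective-onePlusX B B₀≈1 with unitriangular-surjective σ-lowerOrder σ-lowerOrder-local B
  ... | A , solves = A , A₀≈1 , λ n → trans (σ-onePlusX A₀≈1 n) (solves n)
    where
      A₀≈1 : OnePlusX R A
      A₀≈1 = trans (sym (+-identityʳ (A 0))) (trans (solves 0) B₀≈1)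

proposition4p3 : ∀ {c ℓ} (K : SubfieldOfF2bar c ℓ) →
    let open SubfieldOfF2bar K in
    -- σ maps 1 + X K[[X]] into itself
    (∀ (A : PowerSeries cring) → OnePlusX cring A → OnePlusX cring (σ cring A))
    -- injective on 1 + X K[[X]] (series equality = coefficientwise ≈)
    × (∀ (A B : PowerSeries cring) → OnePlusX cring A → OnePlusX cring B →
         (∀ (n : ℕ) → σ cring A n ≈ σ cring B n) → ∀ (n : ℕ) → A n ≈ B n)
    -- surjective onto 1 + X K[[X]]
    × (∀ (B : PowerSeries cring) → OnePlusX cring B →
         ∃ λ (A : PowerSeries cring) → OnePlusX cring A × (∀ (n : ℕ) → σ cring A n ≈ B n))
proposition4p3 K = σ-preserves-onePlusX , σ-injective-onePlusX , σ-surjective-onePlusX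
  where open SigmaCoefficients (SubfieldOfF2bar.cring K)
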